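{- Let $f:\mathbb{N}\to\mathbb{C}$ be a multiplicative function. If there exists an integer $k$ with $|k|\ge 2$ such that $f^{k\circ}(n)=k^{\Omega(n)}f(n)$ for all $n\ge1$, then $f$ is completely multiplicative.
   Context: A function $f$ is multiplicative if $f(1)=1$ and $f(mn)=f(m)f(n)$ whenever $\gcd(m,n)=1$; completely multiplicative if $f(1)=1$ and $f(mn)=f(m)f(n)$ for all $m,n$. For $n\in\mathbb{N}$ write $n=\prod_p p^{\nu_p(n)}$ and $\Omega(n)=\sum_p\nu_p(n)$. The binomial convolution is $(f\circ g)(n)=\sum_{d\mid n}\left(\prod_p\binom{\nu_p(n)}{\nu_p(d)}\right)f(d)g(n/d)$, with identity $\delta$ ($\delta(1)=1$, $\delta(n)=0$ for $n>1$). For $k>0$, $f^{k\circ}=f\circ\cdots\circ f$ ($k$ factors) and $f^{ -k\circ}=f^{ -1\circ}\circ\cdots\circ f^{ -1\circ}$ ($k$ factors), where $f^{ -1\circ}$ is the inverse of $f$ under $\circ$ (which exists for multiplicative $f$ since $f(1)=1$). -}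

module Defs where

open import Level using (Level)
open import Algebra.Bundles using (CommutativeRing)
open import Data.Nat as ℕ using (ℕ; zero; suc; _≤_)
open import Data.Nat.Divisibility using (_∣?_)
open import Data.Nat.DivMod using (_/_; _%_)
open import Data.Nat.Primality using (prime?)
open import Data.Nat.Coprimality using (Coprime)
open import Data.Nat.Combinatorics using (_C_)
open import Data.Integer as ℤ using (ℤ; +_; -[1+_])
open import Data.Product using (Σ; ∃; _×_)
open import Relation.Nullary using (¬_; does)
open import Data.Bool using (if_then_else_)

-- ν p n : the p-adic valuation of n (for p ≥ 2, n ≥ 1), computed with fuel n
-- (fuel n suffices since p^ν ≤ n).
νfuel : ℕ → ℕ → ℕ → ℕ
νfuel zero    p             n       = 0
νfuel (suc t) zero          n       = 0
νfuel (suc t) (suc zero)    n       = 0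
νfuel (suc t) (suc (suc q)) zero    = 0
νfuel (suc t) (suc (suc q)) (suc m) =
  if does (suc (suc q) ∣? suc m)
  then suc (νfuel t (suc (suc q)) (suc m / suc (suc q)))
  else 0

ν : ℕ → ℕ → ℕ
ν p n = νfuel n p n

sumPrimesUpTo : ℕ → (ℕ → ℕ) → ℕ
sumPrimesUpTo zero    g = 0
sumPrimesUpTo (suc m) g =
  (if does (prime? (suc m)) then g (suc m) else 0) ℕ.+ sumPrimesUpTo m g

prodPrimesUpTo : ℕ → (ℕ → ℕ) → ℕ
prodPrimesUpTo zero    g = 1
prodPrimesUpTo (suc m) g =
  (if does (prime? (suc m)) then g (suc m) else 1) ℕ.* prodPrimesUpTo m g

-- Ω(n) = Σ_p ν_p(n)  (only primes p ≤ n can divide n ≥ 1)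
Ω : ℕ → ℕ
Ω n = sumPrimesUpTo n (λ p → ν p n)

binomFactor : ℕ → ℕ → ℕ
binomFactor n d = prodPrimesUpTo n (λ p → ν p n C ν p d)

module _ {c ℓ : Level} (R : CommutativeRing c ℓ) where
  open CommutativeRing R

  natR : ℕ → Carrier
  natR zero    = 0#
  natR (suc n) = 1# + natR n

  intR : ℤ → Carrier
  intR (+ n)    = natR n
  intR -[1+ n ] = - natR (suc n)

  powR : Carrier → ℕ → Carrier
  powR x zero    = 1#
  powR x (suc m) = x * powR x m

  IsField : Set (c Level.⊔ ℓ)
  IsField = (¬ (0# ≈ 1#)) × (∀ x → ¬ (x ≈ 0#) → ∃ λ y → x * y ≈ 1#)

  CharZero : Set ℓ
  CharZero = ∀ n → ¬ (natR (suc n) ≈ 0#)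

  ArithFun : Set c
  ArithFun = ℕ → Carrier

  δ : ArithFun
  δ (suc zero) = 1#
  δ _          = 0#

  sumUpTo : ℕ → (ℕ → Carrier) → Carrier
  sumUpTo zero    g = 0#
  sumUpTo (suc m) g = g (suc m) + sumUpTo m g

  _⊚_ : ArithFun → ArithFun → ArithFun
  (f ⊚ g) n = sumUpTo n term
    where
    term : ℕ → Carrier
    term zero    = 0#
    term (suc i) =
      if does (suc i ∣? n)
      then natR (binomFactor n (suc i)) * (f (suc i) * g (n / suc i))
      else 0#

  -- convPow f k = f ⊚ (f ⊚ ( ... ⊚ δ)) with k factors f, i.e. f^{k∘}
  -- (for k ≥ 1 this agrees with f ∘ ⋯ ∘ f at every n ≥ 1 since δ is the unit)
  convPow : ArithFun → ℕ → ArithFun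
  convPow f zero    = δ
  convPow f (suc k) = f ⊚ convPow f k

  IsConvInverse : ArithFun → ArithFun → Set ℓ
  IsConvInverse f g = ∀ n → 1 ≤ n → (f ⊚ g) n ≈ δ n

  Multiplicative : ArithFun → Set ℓ
  Multiplicative f =
    (f 1 ≈ 1#) ×
    (∀ m n → 1 ≤ m → 1 ≤ n → Coprime m n → f (m ℕ.* n) ≈ f m * f n)

  CompletelyMultiplicative : ArithFun → Set ℓ
  CompletelyMultiplicative f =
    (f 1 ≈ 1#) ×
    (∀ m n → 1 ≤ m → 1 ≤ n → f (m ℕ.* n) ≈ f m * f n)

  -- f^{k∘} for an integer k ≠ 0, given as "h = f^{k∘}" relation:
  -- for k > 0, f^{k∘} = convPow f k; for k < 0, f^{k∘} = convPow g |k|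
  -- where g is the ⊚-inverse of f (unique on n ≥ 1).
  PowerIdentity : ArithFun → ℤ → Set (c Level.⊔ ℓ)
  PowerIdentity f (+ k) =
    Level.Lift c (∀ n → 1 ≤ n → convPow f k n ≈ powR (intR (+ k)) (Ω n) * f n)
  PowerIdentity f -[1+ k ] =
    Σ ArithFun λ g → IsConvInverse f g ×
      (∀ n → 1 ≤ n → convPow g (suc k) n ≈ powR (intR -[1+ k ]) (Ω n) * f n)

{-# OPTIONS --safe #-}
module Submission where

-- At a prime power, f ⊚ g becomes the binomial convolution (u ⋆ w)(a) = Σ_j C(a,j) u(j) w(a-j)
-- of the exponent sequences u(j) = f(p^j), w(j) = g(p^j), and Ω(p^a) = a; so the hypothesis
-- reads (u^⋆k)(a) = k^a u(a).  Let γ = u(1).  By the binomial theorem (γ^·)^⋆k = (kγ)^·, and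
-- if u agrees with γ^· below a ≥ 2 then (u^⋆k)(a) and ((γ^·)^⋆k)(a) differ by exactly
-- k (u(a) - γ^a), since u(a) only enters through the first and last terms of each
-- convolution.  The hypothesis makes the same difference k^a (u(a) - γ^a); as k^a ≠ k in
-- characteristic 0, u(a) = γ^a.  For k < 0 the argument runs through the inverse w of u,
-- which agrees with (-γ)^· wherever u agrees with γ^·.  Hence f(p^a) = f(p)^a, and a
-- multiplicative function with this property is completely multiplicative.

open import Defs
open import Level using (Level)
open import Algebra.Bundles using (CommutativeRing)
open import Data.Integer using (ℤ; ∣_∣)
open import Data.Nat using (_≤_)
open import Data.Product using (∃; _×_; _,_)

module PrimePowers where

  open import Data.Nat.Base using (ℕ; zero; suc; _+_; _*_; _^_; _∸_; _<_; z≤n; s≤s; z<s; >-nonZero; nonTrivial⇒n>1)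
  open import Data.Nat.Properties
  open import Data.Nat.Divisibility using (_∣_; _∣?_; divides; ∣1⇒≡1; ∣-trans; m∣m*n; *-cancelʳ-∣)
  open import Data.Nat.DivMod using (_/_; m*n/n≡m)
  open import Data.Nat.Primality using (Prime; prime?; prime⇒irreducible; prime⇒nonTrivial)
  open import Data.Nat.Primality.Factorisation using (factorise)
  open import Data.Nat.Coprimality using (Coprime; coprime-divisor)
  open import Data.Nat.Combinatorics using (_C_)
  open import Data.Nat.Induction using (<-rec)
  open import Data.Nat.ListAction using (product)
  open import Data.List.Base using ([]; _∷_)
  open import Data.List.Relation.Unary.All using (_∷_)
  open import Data.Bool.Properties using (if-cong)
  open import Data.Product using (∃₂)
  open import Data.Sum using (inj₁; inj₂)
  open import Relation.Nullary using (¬_; yes; no; contradiction)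
  open import Relation.Nullary.Decidable using (dec-true; dec-false)
  open import Relation.Binary.PropositionalEquality
    using (_≡_; _≢_; ≢-sym; refl; sym; trans; cong; cong₂; subst; subst₂)

  prime>1 : ∀ {p} → Prime p → 1 < p
  prime>1 {p} pp = nonTrivial⇒n>1 p {{prime⇒nonTrivial pp}}

  1≤p^a : ∀ {p} → 1 < p → ∀ a → 1 ≤ p ^ a
  1≤p^a {p} 1<p a = m^n>0 p {{>-nonZero (<-trans z<s 1<p)}} a

  p≤p^[1+a] : ∀ {p} → 1 < p → ∀ a → p ≤ p ^ suc a
  p≤p^[1+a] {p} 1<p a = m≤m*n p (p ^ a) {{>-nonZero (1≤p^a 1<p a)}}

  m<m^n : ∀ {m n} → 1 < m → 1 < n → m < m ^ n
  m<m^n {m} {n} 1<m 1<n = subst (_< m ^ n) (^-identityʳ m) (^-monoʳ-< m 1<m 1<n)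

  p^a≡p^[a∸j]*p^j : ∀ p {a j} → j ≤ a → p ^ a ≡ p ^ (a ∸ j) * p ^ j
  p^a≡p^[a∸j]*p^j p {a} {j} j≤a = trans (cong (p ^_) (sym (m∸n+n≡m j≤a))) (^-distribˡ-+-* p (a ∸ j) j)

  between-powers⇒≢p^j : ∀ {p} → 1 < p → ∀ a {i} → p ^ a < i → i < p ^ suc a → ∀ j → i ≢ p ^ j
  between-powers⇒≢p^j {p} 1<p a p^a<i i<p^[1+a] j refl with j ≤? a
  ... | yes j≤a = <⇒≱ p^a<i (^-monoʳ-≤ p {{>-nonZero (<-trans z<s 1<p)}} j≤a)
  ... | no j≰a  = <⇒≱ i<p^[1+a] (^-monoʳ-≤ p {{>-nonZero (<-trans z<s 1<p)}} (≰⇒> j≰a))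

  ∣p^a⇒≡p^j : ∀ {p d} → Prime p → ∀ a → d ∣ p ^ a → ∃ λ j → j ≤ a × d ≡ p ^ j
  ∣p^a⇒≡p^j pp zero d∣1 = 0 , z≤n , ∣1⇒≡1 d∣1
  ∣p^a⇒≡p^j {p} {d} pp (suc a) d∣p^[1+a] with p ∣? d
  ... | yes (divides q refl) with ∣p^a⇒≡p^j pp a q∣p^a
    where
    q∣p^a : q ∣ p ^ a
    q∣p^a = *-cancelʳ-∣ p {{>-nonZero (<-trans z<s (prime>1 pp))}}
              (subst (q * p ∣_) (*-comm p (p ^ a)) d∣p^[1+a])
  ...   | j , j≤a , refl = suc j , s≤s j≤a , *-comm (p ^ j) p
  ∣p^a⇒≡p^j {p} {d} pp (suc a) d∣p^[1+a] | no p∤d with ∣p^a⇒≡p^j pp a (coprime-divisor d⊥p d∣p^[1+a])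
    where
    d⊥p : Coprime d p
    d⊥p (e∣d , e∣p) with prime⇒irreducible pp e∣p
    ... | inj₁ e≡1  = e≡1
    ... | inj₂ refl = contradiction e∣d p∤d
  ...   | j , j≤a , d≡p^j = j , m≤n⇒m≤1+n j≤a , d≡p^j

  prime∤p^a : ∀ {p q} → Prime p → Prime q → q ≢ p → ∀ a → ¬ q ∣ p ^ a
  prime∤p^a {p} {q} pp pq q≢p a q∣p^a with ∣p^a⇒≡p^j {d = q} pp a q∣p^a
  ... | zero  , _ , refl = <-irrefl refl (prime>1 pq)
  ... | suc j , _ , refl with prime⇒irreducible pq (m∣m*n {p} (p ^ j))
  ...   | inj₁ refl = <-irrefl refl (prime>1 pp)
  ...   | inj₂ p≡q  = q≢p (sym p≡q)

  coprime-p^e : ∀ {p m} → Prime p → ¬ p ∣ m → ∀ e → Coprime (p ^ e) m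
  coprime-p^e {p} pp p∤m e (d∣p^e , d∣m) with ∣p^a⇒≡p^j pp e d∣p^e
  ... | zero  , _ , d≡1  = d≡1
  ... | suc j , _ , refl = contradiction (∣-trans (m∣m*n (p ^ j)) d∣m) p∤m

  ∃-prime-divisor : ∀ {n} → 1 < n → ∃ λ p → Prime p × p ∣ n
  ∃-prime-divisor {n} 1<n with factorise n {{>-nonZero (<-trans z<s 1<n)}}
  ... | record { factors = [] ; isFactorisation = n≡1 } = contradiction (sym n≡1) (<⇒≢ 1<n)
  ... | record { factors = p ∷ ps ; isFactorisation = n≡p*ps ; factorsPrime = pp ∷ _ } =
    p , pp , subst (p ∣_) (sym n≡p*ps) (m∣m*n (product ps))

  p-free-part : ∀ {p} → 1 < p → ∀ n → 1 ≤ n → ∃₂ λ e m → n ≡ p ^ e * m × ¬ p ∣ m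
  p-free-part {p} 1<p = <-rec _ split
    where
    split : ∀ n → (∀ {m} → m < n → 1 ≤ m → ∃₂ λ e m′ → m ≡ p ^ e * m′ × ¬ p ∣ m′) →
            1 ≤ n → ∃₂ λ e m → n ≡ p ^ e * m × ¬ p ∣ m
    split n rec 1≤n with p ∣? n
    ... | no p∤n = 0 , n , sym (+-identityʳ n) , p∤n
    ... | yes (divides q refl) with rec q<q*p 1≤q
      where
      1≤q : 1 ≤ q
      1≤q = n≢0⇒n>0 λ { refl → <-irrefl refl 1≤n }
      q<q*p : q < q * p
      q<q*p = m<m*n q p {{>-nonZero 1≤q}} 1<p
    ...   | e , m , refl , p∤m = suc e , m , trans (*-comm (p ^ e * m) p) (sym (*-assoc p (p ^ e) m)) , p∤m

  module _ {q m : ℕ} (p∤m : ¬ suc (suc q) ∣ m) (1≤m : 1 ≤ m) where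
    private
      p = suc (suc q)

      1≤p^e*m : ∀ e → 1 ≤ p ^ e * m
      1≤p^e*m e = *-mono-≤ (1≤p^a (s≤s (s≤s z≤n)) e) 1≤m

    νfuel-p^e*m≡e : ∀ t e n → n ≡ p ^ e * m → n ≤ t → νfuel t p n ≡ e
    νfuel-p^e*m≡e zero    e       n       refl n≤0 = contradiction (≤-trans (1≤p^e*m e) n≤0) λ ()
    νfuel-p^e*m≡e (suc t) e       zero    n≡    _  = contradiction (subst (1 ≤_) (sym n≡) (1≤p^e*m e)) λ ()
    νfuel-p^e*m≡e (suc t) zero    (suc n) n≡    _  =
      if-cong (dec-false (p ∣? suc n) λ p∣n → p∤m (subst (p ∣_) (trans n≡ (*-identityˡ m)) p∣n))
    νfuel-p^e*m≡e (suc t) (suc e) (suc n) n≡ 1+n≤1+t =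
      trans (if-cong (dec-true (p ∣? suc n) (divides k n≡k*p)))
            (cong suc (νfuel-p^e*m≡e t e (suc n / p) n/p≡k (≤-pred (<-≤-trans n/p<n 1+n≤1+t))))
      where
      k = p ^ e * m
      n≡k*p : suc n ≡ k * p
      n≡k*p = trans n≡ (trans (*-assoc p (p ^ e) m) (*-comm p k))
      n/p≡k : suc n / p ≡ k
      n/p≡k = trans (cong (_/ p) n≡k*p) (m*n/n≡m k p)
      n/p<n : suc n / p < suc n
      n/p<n = subst₂ _<_ (sym n/p≡k) (sym n≡k*p) (m<m*n k p {{>-nonZero (1≤p^e*m e)}} (s≤s (s≤s z≤n)))

  ν-p^e*m≡e : ∀ {p m} → 1 < p → ¬ p ∣ m → 1 ≤ m → ∀ e → ν p (p ^ e * m) ≡ e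
  ν-p^e*m≡e (s≤s (s≤s _)) p∤m 1≤m e = νfuel-p^e*m≡e p∤m 1≤m _ e _ refl ≤-refl

  ν-p^a≡a : ∀ {p} → Prime p → ∀ a → ν p (p ^ a) ≡ a
  ν-p^a≡a {p} pp a = subst (λ n → ν p n ≡ a) (*-identityʳ (p ^ a))
    (ν-p^e*m≡e (prime>1 pp) (λ p∣1 → <-irrefl (sym (∣1⇒≡1 p∣1)) (prime>1 pp)) (s≤s z≤n) a)

  ν-other-p^a≡0 : ∀ {p q} → Prime p → Prime q → q ≢ p → ∀ a → ν q (p ^ a) ≡ 0
  ν-other-p^a≡0 {p} {q} pp pq q≢p a = subst (λ n → ν q n ≡ 0) (+-identityʳ (p ^ a))
    (ν-p^e*m≡e (prime>1 pq) (prime∤p^a pp pq q≢p a) (1≤p^a (prime>1 pp) a) 0)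

  sumPrimesUpTo-vanishing : ∀ N g → (∀ q → Prime q → q ≤ N → g q ≡ 0) → sumPrimesUpTo N g ≡ 0
  sumPrimesUpTo-vanishing zero    g _   = refl
  sumPrimesUpTo-vanishing (suc N) g g≡0 with prime? (suc N)
  ... | yes pN = cong₂ _+_ (g≡0 _ pN ≤-refl)
                           (sumPrimesUpTo-vanishing N g λ q pq q≤N → g≡0 q pq (m≤n⇒m≤1+n q≤N))
  ... | no _   = sumPrimesUpTo-vanishing N g λ q pq q≤N → g≡0 q pq (m≤n⇒m≤1+n q≤N)

  sumPrimesUpTo-single : ∀ {p} N g → Prime p → p ≤ N → (∀ q → Prime q → q ≢ p → g q ≡ 0) →
                         sumPrimesUpTo N g ≡ g p
  sumPrimesUpTo-single zero g pp p≤0 _ = contradiction (≤-trans (<⇒≤ (prime>1 pp)) p≤0) λ ()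
  sumPrimesUpTo-single (suc N) g pp p≤1+N g≡0 with m≤n⇒m<n∨m≡n p≤1+N | prime? (suc N)
  ... | inj₂ refl | yes _ =
    trans (cong (g _ +_) (sumPrimesUpTo-vanishing N g λ q pq q≤N → g≡0 q pq (<⇒≢ (s≤s q≤N))))
          (+-identityʳ _)
  ... | inj₂ refl | no ¬p = contradiction pp ¬p
  ... | inj₁ p≤N  | yes pN =
    cong₂ _+_ (g≡0 _ pN (≢-sym (<⇒≢ p≤N))) (sumPrimesUpTo-single N g pp (≤-pred p≤N) g≡0)
  ... | inj₁ p≤N  | no _ = sumPrimesUpTo-single N g pp (≤-pred p≤N) g≡0

  prodPrimesUpTo-vanishing : ∀ N g → (∀ q → Prime q → q ≤ N → g q ≡ 1) → prodPrimesUpTo N g ≡ 1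
  prodPrimesUpTo-vanishing zero    g _   = refl
  prodPrimesUpTo-vanishing (suc N) g g≡1 with prime? (suc N)
  ... | yes pN = cong₂ _*_ (g≡1 _ pN ≤-refl)
                           (prodPrimesUpTo-vanishing N g λ q pq q≤N → g≡1 q pq (m≤n⇒m≤1+n q≤N))
  ... | no _   = trans (+-identityʳ _) (prodPrimesUpTo-vanishing N g λ q pq q≤N → g≡1 q pq (m≤n⇒m≤1+n q≤N))

  prodPrimesUpTo-single : ∀ {p} N g → Prime p → p ≤ N → (∀ q → Prime q → q ≢ p → g q ≡ 1) →
                          prodPrimesUpTo N g ≡ g p
  prodPrimesUpTo-single zero g pp p≤0 _ = contradiction (≤-trans (<⇒≤ (prime>1 pp)) p≤0) λ ()
  prodPrimesUpTo-single (suc N) g pp p≤1+N g≡1 with m≤n⇒m<n∨m≡n p≤1+N | prime? (suc N)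
  ... | inj₂ refl | yes _ =
    trans (cong (g _ *_) (prodPrimesUpTo-vanishing N g λ q pq q≤N → g≡1 q pq (<⇒≢ (s≤s q≤N))))
          (*-identityʳ _)
  ... | inj₂ refl | no ¬p = contradiction pp ¬p
  ... | inj₁ p≤N  | yes pN =
    trans (cong (_* prodPrimesUpTo N g) (g≡1 _ pN (≢-sym (<⇒≢ p≤N))))
          (trans (*-identityˡ _) (prodPrimesUpTo-single N g pp (≤-pred p≤N) g≡1))
  ... | inj₁ p≤N  | no _ = trans (+-identityʳ _) (prodPrimesUpTo-single N g pp (≤-pred p≤N) g≡1)

  Ω-p^a≡a : ∀ {p} → Prime p → ∀ a → Ω (p ^ a) ≡ a
  Ω-p^a≡a pp zero    = refl
  Ω-p^a≡a pp (suc a) =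
    trans (sumPrimesUpTo-single _ _ pp (p≤p^[1+a] (prime>1 pp) a) λ q pq q≢p → ν-other-p^a≡0 pp pq q≢p (suc a))
          (ν-p^a≡a pp (suc a))

  binomFactor-p^a-p^j≡aCj : ∀ {p} → Prime p → ∀ {a j} → j ≤ a → binomFactor (p ^ a) (p ^ j) ≡ a C j
  binomFactor-p^a-p^j≡aCj pp {zero}      z≤n = refl
  binomFactor-p^a-p^j≡aCj pp {suc a} {j} _   =
    trans (prodPrimesUpTo-single _ _ pp (p≤p^[1+a] (prime>1 pp) a)
             λ q pq q≢p → cong₂ _C_ (ν-other-p^a≡0 pp pq q≢p (suc a)) (ν-other-p^a≡0 pp pq q≢p j))
          (cong₂ _C_ (ν-p^a≡a pp (suc a)) (ν-p^a≡a pp j))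

open PrimePowers

module _ {c ℓ : Level} (R : CommutativeRing c ℓ) where

  open import Level using (lift)
  open import Data.Integer.Base using (+_; -[1+_])
  open import Data.Nat.Base as ℕ using (ℕ; zero; suc; _∸_; _<_; z≤n; s≤s; z<s; _<′_; ≤′-refl; ≤′-step)
  import Data.Nat.Properties as ℕₚ
  open import Data.Nat.Properties
    using (≤-refl; <-trans; <-≤-trans; <⇒≤; <⇒≢; n≤1+n; n<1+n; <⇒<′; <′⇒<; m∸n≤m; n∸n≡0; m+[n∸m]≡n;
           m>n⇒m∸n≢0; m≤n+m; n≢0⇒n>0; m≤n⇒m<n∨m≡n; m<1+n⇒m<n∨m≡n; ^-monoʳ-<; m^n≢0)
  open import Data.Nat.Divisibility using (_∣_; _∣?_; divides; _∣0)
  open import Data.Nat.DivMod using (_/_; m*n/n≡m)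
  open import Data.Nat.Primality using (Prime; prime⇒nonZero)
  open import Data.Nat.Combinatorics using (_C_; nCn≡1)
  open import Data.Nat.Induction using (<-rec)
  open import Data.Fin.Base using (Fin; zero; suc; toℕ; inject₁; fromℕ)
  open import Data.Fin.Properties using (toℕ<n; toℕ-inject₁; toℕ-fromℕ; toℕ≤pred[n])
  open import Data.Bool.Base using (if_then_else_)
  open import Data.Bool.Properties using (if-cong)
  open import Data.Product using (proj₁; proj₂)
  open import Data.Sum using (_⊎_; inj₁; inj₂)
  open import Function.Base using (_∘_)
  open import Relation.Nullary using (¬_; does; contradiction)
  open import Relation.Nullary.Decidable using (dec-true; dec-false)
  open import Relation.Binary.PropositionalEquality as ≡ using (_≡_; _≢_)

  open CommutativeRing R
  open import Algebra.Properties.Ring ring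
    using (-‿distribˡ-*; -‿distribʳ-*; -‿involutive; -0#≈0#; -‿+-comm; +-inverseʳ-unique;
           x∙y⁻¹≈ε⇒x≈y; x≈y⇒x∙y⁻¹≈ε; x[y-z]≈xy-xz; [y-z]x≈yx-zx; xyx⁻¹≈y)
  open import Algebra.Properties.Semiring.Mult semiring
    using (×-congʳ; ×-assoc-*; ×-homo-+; ×1-homo-*) renaming (_×_ to _·_)
  open import Algebra.Properties.Semiring.Sum semiring
    using (sum-syntax; sum⁺-syntax; sum-cong-≋; sum-cong-≗; sum-init-last)
  open import Algebra.Properties.Semiring.Exp semiring using (_^_; ^-congˡ)
  open import Algebra.Properties.CommutativeSemiring.Exp commutativeSemiring using (^-distrib-*)
  import Algebra.Properties.CommutativeSemiring.Binomial commutativeSemiring as Binomial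
  open import Algebra.Solver.CommutativeMonoid +-commutativeMonoid using (solve; _⊕_; _⊜_)
  open import Relation.Binary.Reasoning.Setoid setoid

  natR≡·1# : ∀ n → natR R n ≡ n · 1#
  natR≡·1# zero    = ≡.refl
  natR≡·1# (suc n) = ≡.cong (_+_ 1#) (natR≡·1# n)

  powR≡^ : ∀ x n → powR R x n ≡ x ^ n
  powR≡^ x zero    = ≡.refl
  powR≡^ x (suc n) = ≡.cong (x *_) (powR≡^ x n)

  ·-as-* : ∀ n x → n · x ≈ (n · 1#) * x
  ·-as-* n x = sym (trans (×-assoc-* n 1# x) (×-congʳ n (*-identityˡ x)))

  x*-y≈-x*y : ∀ x y → x * - y ≈ - x * y
  x*-y≈-x*y x y = trans (sym (-‿distribʳ-* x y)) (-‿distribˡ-* x y)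

  -- Binomial convolution of sequences

  Seq : Set c
  Seq = ℕ → Carrier

  ε⋆ : Seq
  ε⋆ zero    = 1#
  ε⋆ (suc _) = 0#

  ⋆-term : Seq → Seq → (a : ℕ) → Fin (suc a) → Carrier
  ⋆-term u w a k = (a C toℕ k) · (u (toℕ k) * w (a ∸ toℕ k))

  infixl 7 _⋆_
  _⋆_ : Seq → Seq → Seq
  (u ⋆ w) a = ∑[ k ≤ a ] ⋆-term u w a k

  infixr 8 _^⋆_
  _^⋆_ : Seq → ℕ → Seq
  u ^⋆ zero  = ε⋆
  u ^⋆ suc k = u ⋆ u ^⋆ k

  infix 4 _≈[<_]_
  _≈[<_]_ : Seq → ℕ → Seq → Set ℓ
  u ≈[< a ] v = ∀ j → j < a → u j ≈ v j

  ≈[<]-restrict : ∀ {u v a b} → b ℕ.≤ a → u ≈[< a ] v → u ≈[< b ] v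
  ≈[<]-restrict b≤a u≈v j j<b = u≈v j (<-≤-trans j<b b≤a)

  ⋆-cong : ∀ {u u′ w w′ a} → u ≈[< suc a ] u′ → w ≈[< suc a ] w′ → (u ⋆ w) a ≈ (u′ ⋆ w′) a
  ⋆-cong {a = a} u≈u′ w≈w′ = sum-cong-≋ λ k →
    ×-congʳ (a C toℕ k) (*-cong (u≈u′ _ (toℕ<n k)) (w≈w′ _ (s≤s (m∸n≤m a (toℕ k)))))

  ^⋆-cong : ∀ {u u′ a} k → u ≈[< a ] u′ → u ^⋆ k ≈[< a ] u′ ^⋆ k
  ^⋆-cong zero    _    _ _   = refl
  ^⋆-cong (suc k) u≈u′ j j<a = ⋆-cong (≈[<]-restrict j<a u≈u′) (≈[<]-restrict j<a (^⋆-cong k u≈u′))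

  ⋆-at-0 : ∀ u w → (u ⋆ w) 0 ≈ u 0 * w 0
  ⋆-at-0 u w = trans (+-identityʳ _) (+-identityʳ _)

  ^⋆-at-0 : ∀ {u} → u 0 ≈ 1# → ∀ k → (u ^⋆ k) 0 ≈ 1#
  ^⋆-at-0     u0≈1 zero    = refl
  ^⋆-at-0 {u} u0≈1 (suc k) =
    trans (⋆-at-0 u (u ^⋆ k)) (trans (*-cong u0≈1 (^⋆-at-0 u0≈1 k)) (*-identityˡ 1#))

  ⋆-geometric : ∀ x y a → ((x ^_) ⋆ (y ^_)) a ≈ (x + y) ^ a
  ⋆-geometric x y a = sym (Binomial.theorem a x y)

  ^⋆-geometric : ∀ x k a → ((x ^_) ^⋆ k) a ≈ (k · x) ^ a
  ^⋆-geometric x zero    zero    = refl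
  ^⋆-geometric x zero    (suc a) = sym (zeroˡ _)
  ^⋆-geometric x (suc k) a =
    trans (⋆-cong {u = x ^_} (λ _ _ → refl) (λ j _ → ^⋆-geometric x k j)) (⋆-geometric x (k · x) a)

  ⋆-inner : Seq → Seq → ℕ → Carrier
  ⋆-inner u w b = ∑[ k < b ] ⋆-term u w (suc b) (suc (inject₁ k))

  ⋆-term-last : ∀ u w a → ⋆-term u w a (fromℕ a) ≈ u a * w 0
  ⋆-term-last u w a rewrite toℕ-fromℕ a | nCn≡1 a | n∸n≡0 a = +-identityʳ _

  ⋆-split : ∀ u w b → u 0 ≈ 1# → w 0 ≈ 1# → (u ⋆ w) (suc b) ≈ w (suc b) + (⋆-inner u w b + u (suc b))
  ⋆-split u w b u0≈1 w0≈1 = +-cong first (trans (sum-init-last (⋆-term u w (suc b) ∘ suc)) (+-congˡ last))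
    where
    first : (suc b C 0) · (u 0 * w (suc b)) ≈ w (suc b)
    first = trans (+-identityʳ _) (trans (*-congʳ u0≈1) (*-identityˡ _))
    last : ⋆-term u w (suc b) (fromℕ (suc b)) ≈ u (suc b)
    last = trans (⋆-term-last u w (suc b)) (trans (*-congˡ w0≈1) (*-identityʳ _))

  ⋆-inner-cong : ∀ {u u′ w w′ b} → u ≈[< suc b ] u′ → w ≈[< suc b ] w′ → ⋆-inner u w b ≈ ⋆-inner u′ w′ b
  ⋆-inner-cong {b = b} u≈u′ w≈w′ = sum-cong-≋ λ k →
    ×-congʳ (suc b C suc (toℕ (inject₁ k)))
      (*-cong (u≈u′ _ (s≤s (≡.subst (_< b) (≡.sym (toℕ-inject₁ k)) (toℕ<n k))))
              (w≈w′ _ (s≤s (m∸n≤m b (toℕ (inject₁ k))))))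

  ⋆-top : ∀ {u u′ w w′ b} → u ≈[< suc b ] u′ → w ≈[< suc b ] w′ → u 0 ≈ 1# → w 0 ≈ 1# →
          (u ⋆ w) (suc b) - (u′ ⋆ w′) (suc b) ≈ (u (suc b) - u′ (suc b)) + (w (suc b) - w′ (suc b))
  ⋆-top {u} {u′} {w} {w′} {b} u≈u′ w≈w′ u0≈1 w0≈1 = begin
    (u ⋆ w) a - (u′ ⋆ w′) a                        ≈⟨ +-cong (⋆-split u w b u0≈1 w0≈1) (-‿cong split′) ⟩
    (w a + (I + u a)) - (w′ a + (I + u′ a))        ≈⟨ +-congˡ -‿distrib ⟩
    (w a + (I + u a)) + (- w′ a + (- I + - u′ a))  ≈⟨ rearrange ⟩
    ((u a - u′ a) + (w a - w′ a)) + (I - I)        ≈⟨ +-congˡ (-‿inverseʳ I) ⟩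
    ((u a - u′ a) + (w a - w′ a)) + 0#             ≈⟨ +-identityʳ _ ⟩
    (u a - u′ a) + (w a - w′ a)                    ∎
    where
    a = suc b
    I = ⋆-inner u w b
    split′ : (u′ ⋆ w′) a ≈ w′ a + (I + u′ a)
    split′ = trans (⋆-split u′ w′ b (trans (sym (u≈u′ 0 z<s)) u0≈1) (trans (sym (w≈w′ 0 z<s)) w0≈1))
                   (+-congˡ (+-congʳ (sym (⋆-inner-cong u≈u′ w≈w′))))
    -‿distrib : - (w′ a + (I + u′ a)) ≈ - w′ a + (- I + - u′ a)
    -‿distrib = sym (trans (+-congˡ (-‿+-comm I (u′ a))) (-‿+-comm (w′ a) _))
    rearrange : (w a + (I + u a)) + (- w′ a + (- I + - u′ a)) ≈ ((u a - u′ a) + (w a - w′ a)) + (I - I)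
    rearrange = solve 6 (λ W W′ J J′ U U′ → (W ⊕ (J ⊕ U)) ⊕ (W′ ⊕ (J′ ⊕ U′)) ⊜ ((U ⊕ U′) ⊕ (W ⊕ W′)) ⊕ (J ⊕ J′))
                        refl (w a) (- w′ a) I (- I) (u a) (- u′ a)

  ^⋆-top : ∀ {u v b} k → u ≈[< suc b ] v → u 0 ≈ 1# →
           (u ^⋆ k) (suc b) - (v ^⋆ k) (suc b) ≈ k · (u (suc b) - v (suc b))
  ^⋆-top zero    _   _    = -‿inverseʳ 0#
  ^⋆-top (suc k) u≈v u0≈1 =
    trans (⋆-top u≈v (^⋆-cong k u≈v) u0≈1 (^⋆-at-0 u0≈1 k)) (+-congˡ (^⋆-top k u≈v u0≈1))

  module _ {u w : Seq} (u⋆w≈ε : ∀ a → (u ⋆ w) a ≈ ε⋆ a) (u0≈1 : u 0 ≈ 1#) where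

    ⋆-inverse-at-0 : w 0 ≈ 1#
    ⋆-inverse-at-0 = begin
      w 0         ≈⟨ *-identityˡ _ ⟨
      1# * w 0    ≈⟨ *-congʳ u0≈1 ⟨
      u 0 * w 0   ≈⟨ ⋆-at-0 u w ⟨
      (u ⋆ w) 0   ≈⟨ u⋆w≈ε 0 ⟩
      1#          ∎

    ⋆-inverse-top : ∀ {γ b} → u ≈[< suc b ] (γ ^_) → w ≈[< suc b ] ((- γ) ^_) →
                    w (suc b) - (- γ) ^ suc b ≈ - (u (suc b) - γ ^ suc b)
    ⋆-inverse-top {γ} {b} u≈γ^ w≈[-γ]^ = +-inverseʳ-unique _ _ (begin
      (u a - γ ^ a) + (w a - (- γ) ^ a)    ≈⟨ ⋆-top u≈γ^ w≈[-γ]^ u0≈1 ⋆-inverse-at-0 ⟨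
      (u ⋆ w) a - ((γ ^_) ⋆ ((- γ) ^_)) a  ≈⟨ +-cong (u⋆w≈ε a) (-‿cong (⋆-geometric γ (- γ) a)) ⟩
      0# - (γ - γ) ^ a                     ≈⟨ +-congˡ (-‿cong (trans (*-congʳ (-‿inverseʳ γ)) (zeroˡ _))) ⟩
      0# - 0#                              ≈⟨ -‿inverseʳ 0# ⟩
      0#                                   ∎)
      where a = suc b

    ⋆-inverse-next : ∀ {γ} a → u ≈[< suc a ] (γ ^_) → w ≈[< a ] ((- γ) ^_) → w a ≈ (- γ) ^ a
    ⋆-inverse-next zero    _    _       = ⋆-inverse-at-0
    ⋆-inverse-next (suc b) u≈γ^ w≈[-γ]^ = x∙y⁻¹≈ε⇒x≈y _ _ (begin
      w a - (- _) ^ a  ≈⟨ ⋆-inverse-top (≈[<]-restrict (n≤1+n a) u≈γ^) w≈[-γ]^ ⟩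
      - (u a - _ ^ a)  ≈⟨ -‿cong (x≈y⇒x∙y⁻¹≈ε (u≈γ^ a ≤-refl)) ⟩
      - 0#             ≈⟨ -0#≈0# ⟩
      0#               ∎)
      where a = suc b

    ⋆-inverse-geometric : ∀ {γ} a → u ≈[< a ] (γ ^_) → w ≈[< a ] ((- γ) ^_)
    ⋆-inverse-geometric (suc a) u≈γ^ j j<1+a with m<1+n⇒m<n∨m≡n j<1+a
    ... | inj₁ j<a    = ⋆-inverse-geometric a (≈[<]-restrict (n≤1+n a) u≈γ^) j j<a
    ... | inj₂ ≡.refl = ⋆-inverse-next a u≈γ^ (⋆-inverse-geometric a (≈[<]-restrict (n≤1+n a) u≈γ^))

  -- Sequences whose convolution powers are rescalings

  geometric-by-induction : ∀ u → u 0 ≈ 1# → (∀ a → 2 ℕ.≤ a → u ≈[< a ] (u 1 ^_) → u a ≈ u 1 ^ a) →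
                           ∀ a → u a ≈ u 1 ^ a
  geometric-by-induction u u0≈1 step = <-rec _ go
    where
    go : ∀ a → (∀ {j} → j < a → u j ≈ u 1 ^ j) → u a ≈ u 1 ^ a
    go zero            _     = u0≈1
    go (suc zero)      _     = sym (*-identityʳ _)
    go a@(suc (suc _)) below = step a (s≤s (s≤s z≤n)) λ j → below

  PowersAvoidSelf : Carrier → Set ℓ
  PowersAvoidSelf K = ∀ a → 2 ℕ.≤ a → ¬ K ^ a - K ≈ 0#

  module _ (isField : IsField R) where

    *-cancel-≉0 : ∀ {x y} → ¬ x ≈ 0# → x * y ≈ 0# → y ≈ 0#
    *-cancel-≉0 {x} {y} x≉0 xy≈0 with proj₂ isField x x≉0
    ... | x⁻¹ , xx⁻¹≈1 = begin
      y              ≈⟨ *-identityˡ y ⟨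
      1# * y         ≈⟨ *-congʳ xx⁻¹≈1 ⟨
      (x * x⁻¹) * y  ≈⟨ *-congʳ (*-comm x x⁻¹) ⟩
      (x⁻¹ * x) * y  ≈⟨ *-assoc x⁻¹ x y ⟩
      x⁻¹ * (x * y)  ≈⟨ *-congˡ xy≈0 ⟩
      x⁻¹ * 0#       ≈⟨ zeroʳ x⁻¹ ⟩
      0#             ∎

    cancel-scaled-difference : ∀ {K a X Y x y} → ¬ K ^ a - K ≈ 0# →
      X ≈ K ^ a * x → Y ≈ K ^ a * y → X - Y ≈ K * (x - y) → x ≈ y
    cancel-scaled-difference {K} {a} {X} {Y} {x} {y} K^a-K≉0 X≈ Y≈ X-Y≈ =
      x∙y⁻¹≈ε⇒x≈y x y (*-cancel-≉0 K^a-K≉0 (begin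
        (K ^ a - K) * (x - y)                  ≈⟨ [y-z]x≈yx-zx (x - y) (K ^ a) K ⟩
        K ^ a * (x - y) - K * (x - y)          ≈⟨ +-congʳ (x[y-z]≈xy-xz (K ^ a) x y) ⟩
        (K ^ a * x - K ^ a * y) - K * (x - y)  ≈⟨ +-congʳ (+-cong (sym X≈) (-‿cong (sym Y≈))) ⟩
        (X - Y) - K * (x - y)                  ≈⟨ +-congʳ X-Y≈ ⟩
        K * (x - y) - K * (x - y)              ≈⟨ -‿inverseʳ _ ⟩
        0#                                     ∎))

    ^⋆-scaling⇒geometric : ∀ k → PowersAvoidSelf (k · 1#) → ∀ u → u 0 ≈ 1# →
      (∀ a → (u ^⋆ k) a ≈ (k · 1#) ^ a * u a) → ∀ a → u a ≈ u 1 ^ a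
    ^⋆-scaling⇒geometric k avoids u u0≈1 scaling = geometric-by-induction u u0≈1 step
      where
      K = k · 1#
      γ = u 1
      step : ∀ a → 2 ℕ.≤ a → u ≈[< a ] (γ ^_) → u a ≈ γ ^ a
      step a@(suc _) 2≤a u≈γ^ = cancel-scaled-difference {K} {a} (avoids a 2≤a) (scaling a) geometric difference
        where
        geometric : ((γ ^_) ^⋆ k) a ≈ K ^ a * γ ^ a
        geometric = trans (^⋆-geometric γ k a) (trans (^-congˡ a (·-as-* k γ)) (^-distrib-* K γ a))
        difference : (u ^⋆ k) a - ((γ ^_) ^⋆ k) a ≈ K * (u a - γ ^ a)
        difference = trans (^⋆-top k u≈γ^ u0≈1) (·-as-* k _)

    inverse-^⋆-scaling⇒geometric : ∀ m → PowersAvoidSelf (- (m · 1#)) → ∀ u w → u 0 ≈ 1# →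
      (∀ a → (u ⋆ w) a ≈ ε⋆ a) → (∀ a → (w ^⋆ m) a ≈ (- (m · 1#)) ^ a * u a) → ∀ a → u a ≈ u 1 ^ a
    inverse-^⋆-scaling⇒geometric m avoids u w u0≈1 u⋆w≈ε scaling = geometric-by-induction u u0≈1 step
      where
      K = - (m · 1#)
      γ = u 1
      step : ∀ a → 2 ℕ.≤ a → u ≈[< a ] (γ ^_) → u a ≈ γ ^ a
      step a@(suc _) 2≤a u≈γ^ = cancel-scaled-difference {K} {a} (avoids a 2≤a) (scaling a) geometric difference
        where
        w≈[-γ]^ : w ≈[< a ] ((- γ) ^_)
        w≈[-γ]^ = ⋆-inverse-geometric {u} u⋆w≈ε u0≈1 a u≈γ^
        geometric : (((- γ) ^_) ^⋆ m) a ≈ K ^ a * γ ^ a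
        geometric = begin
          (((- γ) ^_) ^⋆ m) a  ≈⟨ ^⋆-geometric (- γ) m a ⟩
          (m · - γ) ^ a        ≈⟨ ^-congˡ a (trans (·-as-* m (- γ)) (x*-y≈-x*y _ γ)) ⟩
          (K * γ) ^ a          ≈⟨ ^-distrib-* K γ a ⟩
          K ^ a * γ ^ a        ∎
        difference : (w ^⋆ m) a - (((- γ) ^_) ^⋆ m) a ≈ K * (u a - γ ^ a)
        difference = begin
          (w ^⋆ m) a - (((- γ) ^_) ^⋆ m) a  ≈⟨ ^⋆-top m w≈[-γ]^ (⋆-inverse-at-0 {u} u⋆w≈ε u0≈1) ⟩
          m · (w a - (- γ) ^ a)             ≈⟨ ×-congʳ m (⋆-inverse-top {u} u⋆w≈ε u0≈1 u≈γ^ w≈[-γ]^) ⟩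
          m · - (u a - γ ^ a)               ≈⟨ ·-as-* m _ ⟩
          (m · 1#) * - (u a - γ ^ a)        ≈⟨ x*-y≈-x*y _ _ ⟩
          K * (u a - γ ^ a)                 ∎

  -‿^-parity : ∀ x a → (- x) ^ a ≈ x ^ a ⊎ (- x) ^ a ≈ - x ^ a
  -‿^-parity x zero = inj₁ refl
  -‿^-parity x (suc a) with -‿^-parity x a
  ... | inj₁ even = inj₂ (trans (*-congˡ even) (sym (-‿distribˡ-* x _)))
  ... | inj₂ odd  = inj₁ (begin
    - x * (- x) ^ a    ≈⟨ *-congˡ odd ⟩
    - x * - x ^ a      ≈⟨ -‿distribʳ-* (- x) _ ⟨
    - (- x * x ^ a)    ≈⟨ -‿cong (-‿distribˡ-* x _) ⟨
    - - (x * x ^ a)    ≈⟨ -‿involutive _ ⟩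
    x * x ^ a          ∎)

  module _ (charZero : CharZero R) where

    ·1#≉0 : ∀ {n} → n ≢ 0 → ¬ n · 1# ≈ 0#
    ·1#≉0 {zero}  n≢0 = contradiction ≡.refl n≢0
    ·1#≉0 {suc n} _   = ≡.subst (λ x → ¬ x ≈ 0#) (natR≡·1# (suc n)) (charZero n)

    ^-homo-·1# : ∀ n a → (n · 1#) ^ a ≈ (n ℕ.^ a) · 1#
    ^-homo-·1# n zero    = sym (+-identityʳ 1#)
    ^-homo-·1# n (suc a) = trans (*-congˡ (^-homo-·1# n a)) (sym (×1-homo-* n (n ℕ.^ a)))

    ∸-homo-·1# : ∀ {m n} → n ℕ.≤ m → (m ∸ n) · 1# ≈ m · 1# - n · 1#
    ∸-homo-·1# {m} {n} n≤m = begin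
      (m ∸ n) · 1#                      ≈⟨ xyx⁻¹≈y (n · 1#) _ ⟨
      (n · 1# + (m ∸ n) · 1#) - n · 1#  ≈⟨ +-congʳ (×-homo-+ 1# n (m ∸ n)) ⟨
      (n ℕ.+ (m ∸ n)) · 1# - n · 1#     ≡⟨ ≡.cong (λ k → k · 1# - n · 1#) (m+[n∸m]≡n n≤m) ⟩
      m · 1# - n · 1#                   ∎

    powers-avoid-self : ∀ {m} → 1 < m → PowersAvoidSelf (m · 1#)
    powers-avoid-self {m} 1<m a 1<a K^a-K≈0 = ·1#≉0 (m>n⇒m∸n≢0 m<m^a) (begin
      (m ℕ.^ a ∸ m) · 1#       ≈⟨ ∸-homo-·1# (<⇒≤ m<m^a) ⟩
      (m ℕ.^ a) · 1# - m · 1#  ≈⟨ +-congʳ (^-homo-·1# m a) ⟨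
      (m · 1#) ^ a - m · 1#    ≈⟨ K^a-K≈0 ⟩
      0#                       ∎)
      where m<m^a = m<m^n 1<m 1<a

    negated-powers-avoid-self : ∀ {m} → 1 < m → PowersAvoidSelf (- (m · 1#))
    negated-powers-avoid-self {m} 1<m a 1<a K^a-K≈0 with -‿^-parity (m · 1#) a
    ... | inj₁ even = ·1#≉0 (λ m^a+m≡0 → <⇒≢ 0<m^a+m (≡.sym m^a+m≡0)) (begin
      (m ℕ.^ a ℕ.+ m) · 1#           ≈⟨ ×-homo-+ 1# (m ℕ.^ a) m ⟩
      (m ℕ.^ a) · 1# + m · 1#        ≈⟨ +-cong (trans (sym (^-homo-·1# m a)) (sym even)) (sym (-‿involutive _)) ⟩
      (- (m · 1#)) ^ a - - (m · 1#)  ≈⟨ K^a-K≈0 ⟩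
      0#                             ∎)
      where 0<m^a+m = <-≤-trans (<-trans z<s 1<m) (m≤n+m m (m ℕ.^ a))
    ... | inj₂ odd = powers-avoid-self 1<m a 1<a (begin
      x ^ a - x            ≈⟨ -‿involutive _ ⟨
      - - (x ^ a - x)      ≈⟨ -‿cong (-‿+-comm _ _) ⟨
      - (- x ^ a - - x)    ≈⟨ -‿cong (+-congʳ odd) ⟨
      - ((- x) ^ a - - x)  ≈⟨ -‿cong K^a-K≈0 ⟩
      - 0#                 ≈⟨ -0#≈0# ⟩
      0#                   ∎)
      where x = m · 1#

  -- Arithmetic functions at prime powers

  powerSeq : ℕ → ArithFun R → Seq
  powerSeq p F j = F (p ℕ.^ j)

  sumUpTo-cong : ∀ n {g h : ℕ → Carrier} → (∀ i → g (suc i) ≈ h (suc i)) → sumUpTo R n g ≈ sumUpTo R n h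
  sumUpTo-cong zero    _   = refl
  sumUpTo-cong (suc n) g≈h = +-cong (g≈h n) (sumUpTo-cong n g≈h)

  sumUpTo-gap : ∀ {L M g} → L < M → (∀ i → L < i → i < M → g i ≈ 0#) → sumUpTo R M g ≈ g M + sumUpTo R L g
  sumUpTo-gap {L} {g = g} L<M = go (<⇒<′ L<M)
    where
    go : ∀ {M} → L <′ M → (∀ i → L < i → i < M → g i ≈ 0#) → sumUpTo R M g ≈ g M + sumUpTo R L g
    go ≤′-refl            _      = refl
    go (≤′-step {M} L<′M) vanish = +-congˡ (begin
      sumUpTo R M g        ≈⟨ go L<′M (λ i L<i i<M → vanish i L<i (<-trans i<M (n<1+n M))) ⟩
      g M + sumUpTo R L g  ≈⟨ +-congʳ (vanish M (<′⇒< L<′M) (n<1+n M)) ⟩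
      0# + sumUpTo R L g   ≈⟨ +-identityˡ _ ⟩
      sumUpTo R L g        ∎)

  sumUpTo-powers : ∀ {p g} → 1 < p → (∀ i → (∀ j → i ≢ p ℕ.^ j) → g i ≈ 0#) →
                   ∀ a → sumUpTo R (p ℕ.^ a) g ≈ ∑[ j ≤ a ] g (p ℕ.^ toℕ j)
  sumUpTo-powers         1<p vanish zero    = refl
  sumUpTo-powers {p} {g} 1<p vanish (suc a) = begin
    sumUpTo R (p ℕ.^ suc a) g                                 ≈⟨ sumUpTo-gap (^-monoʳ-< p 1<p (n<1+n a)) gap ⟩
    g (p ℕ.^ suc a) + sumUpTo R (p ℕ.^ a) g                   ≈⟨ +-congˡ (sumUpTo-powers 1<p vanish a) ⟩
    g (p ℕ.^ suc a) + ∑[ j ≤ a ] g (p ℕ.^ toℕ j)              ≈⟨ +-comm _ _ ⟩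
    ∑[ j ≤ a ] g (p ℕ.^ toℕ j) + g (p ℕ.^ suc a)              ≈⟨ peel-last ⟨
    ∑[ j ≤ suc a ] g (p ℕ.^ toℕ j)                            ∎
    where
    g[p^] : ∀ {i j} → i ≡ j → g (p ℕ.^ i) ≡ g (p ℕ.^ j)
    g[p^] = ≡.cong (λ i → g (p ℕ.^ i))
    peel-last : ∑[ j ≤ suc a ] g (p ℕ.^ toℕ j) ≈ ∑[ j ≤ a ] g (p ℕ.^ toℕ j) + g (p ℕ.^ suc a)
    peel-last = trans (sum-init-last {suc a} (λ j → g (p ℕ.^ toℕ j)))
      (reflexive (≡.cong₂ _+_ (sum-cong-≗ {suc a} (g[p^] ∘ toℕ-inject₁)) (g[p^] (toℕ-fromℕ (suc a)))))
    gap : ∀ i → p ℕ.^ a < i → i < p ℕ.^ suc a → g i ≈ 0#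
    gap i p^a<i i<p^[1+a] = vanish i (between-powers⇒≢p^j 1<p a p^a<i i<p^[1+a])

  -- The summand of _⊚_, indexed by the divisor d itself rather than by d = suc i
  -- (its value at d = 0 is never summed).
  ⊚-term : ArithFun R → ArithFun R → ℕ → ℕ → Carrier
  ⊚-term F G n zero    = 0#
  ⊚-term F G n (suc i) =
    if does (suc i ∣? n) then natR R (binomFactor n (suc i)) * (F (suc i) * G (n / suc i)) else 0#

  ⊚-as-sumUpTo : ∀ F G n → _⊚_ R F G n ≈ sumUpTo R n (⊚-term F G n)
  ⊚-as-sumUpTo F G n = sumUpTo-cong n λ _ → refl

  module _ {p} (pp : Prime p) (F G : ArithFun R) where

    ⊚-term-off-powers : ∀ a i → (∀ j → i ≢ p ℕ.^ j) → ⊚-term F G (p ℕ.^ a) i ≈ 0#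
    ⊚-term-off-powers a zero    _         = refl
    ⊚-term-off-powers a (suc i) not-power = reflexive (if-cong (dec-false (suc i ∣? p ℕ.^ a) λ i∣p^a →
      let j , _ , i≡p^j = ∣p^a⇒≡p^j pp a i∣p^a in not-power j i≡p^j))

    ⊚-term-at-power : ∀ {a j} → j ℕ.≤ a →
                      ⊚-term F G (p ℕ.^ a) (p ℕ.^ j) ≈ (a C j) · (F (p ℕ.^ j) * G (p ℕ.^ (a ∸ j)))
    ⊚-term-at-power {a} {j} j≤a = at (p ℕ.^ j) ≡.refl
      where
      at : ∀ d → d ≡ p ℕ.^ j → ⊚-term F G (p ℕ.^ a) d ≈ (a C j) · (F d * G (p ℕ.^ (a ∸ j)))
      at zero    0≡p^j = contradiction (≡.sym 0≡p^j) (ℕ.≢-nonZero⁻¹ _ {{m^n≢0 p j {{prime⇒nonZero pp}}}})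
      at (suc i) i≡p^j = begin
        ⊚-term F G N (suc i)                                          ≡⟨ if-cong (dec-true (suc i ∣? N) (divides (p ℕ.^ (a ∸ j)) N≡p^[a∸j]*i)) ⟩
        natR R (binomFactor N (suc i)) * (F (suc i) * G (N / suc i))  ≡⟨ ≡.cong₂ (λ b q → natR R b * (F (suc i) * G q)) binomFactor≡ N/i≡ ⟩
        natR R (a C j) * (F (suc i) * G (p ℕ.^ (a ∸ j)))              ≡⟨ ≡.cong (_* _) (natR≡·1# (a C j)) ⟩
        ((a C j) · 1#) * (F (suc i) * G (p ℕ.^ (a ∸ j)))              ≈⟨ ·-as-* (a C j) _ ⟨
        (a C j) · (F (suc i) * G (p ℕ.^ (a ∸ j)))                     ∎
        where
        N = p ℕ.^ a
        N≡p^[a∸j]*i : N ≡ p ℕ.^ (a ∸ j) ℕ.* suc i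
        N≡p^[a∸j]*i = ≡.trans (p^a≡p^[a∸j]*p^j p j≤a) (≡.cong (p ℕ.^ (a ∸ j) ℕ.*_) (≡.sym i≡p^j))
        binomFactor≡ : binomFactor N (suc i) ≡ a C j
        binomFactor≡ = ≡.trans (≡.cong (binomFactor N) i≡p^j) (binomFactor-p^a-p^j≡aCj pp j≤a)
        N/i≡ : N / suc i ≡ p ℕ.^ (a ∸ j)
        N/i≡ = ≡.trans (≡.cong (_/ suc i) N≡p^[a∸j]*i) (m*n/n≡m _ (suc i))

    ⊚-prime-power : ∀ a → _⊚_ R F G (p ℕ.^ a) ≈ (powerSeq p F ⋆ powerSeq p G) a
    ⊚-prime-power a = begin
      _⊚_ R F G (p ℕ.^ a)                            ≈⟨ ⊚-as-sumUpTo F G (p ℕ.^ a) ⟩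
      sumUpTo R (p ℕ.^ a) (⊚-term F G (p ℕ.^ a))     ≈⟨ sumUpTo-powers (prime>1 pp) (⊚-term-off-powers a) a ⟩
      ∑[ j ≤ a ] ⊚-term F G (p ℕ.^ a) (p ℕ.^ toℕ j)  ≈⟨ sum-cong-≋ {suc a} (⊚-term-at-power ∘ toℕ≤pred[n]) ⟩
      (powerSeq p F ⋆ powerSeq p G) a                ∎

  δ-prime-power : ∀ {p} → Prime p → ∀ a → δ R (p ℕ.^ a) ≈ ε⋆ a
  δ-prime-power pp zero    = refl
  δ-prime-power pp (suc a) = reflexive (δ-≥2 (<-≤-trans (prime>1 pp) (p≤p^[1+a] (prime>1 pp) a)))
    where
    δ-≥2 : ∀ {n} → 1 < n → δ R n ≡ 0#
    δ-≥2 {suc zero}    (s≤s ())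
    δ-≥2 {suc (suc _)} _ = ≡.refl

  convPow-prime-power : ∀ {p} → Prime p → ∀ F k a → convPow R F k (p ℕ.^ a) ≈ (powerSeq p F ^⋆ k) a
  convPow-prime-power     pp F zero    a = δ-prime-power pp a
  convPow-prime-power {p} pp F (suc k) a = trans (⊚-prime-power pp F (convPow R F k) a)
    (⋆-cong {u = powerSeq p F} (λ _ _ → refl) (λ j _ → convPow-prime-power pp F k j))

  module _ {f : ArithFun R} (mult : Multiplicative R f)
           (geometric : ∀ {p} → Prime p → ∀ e → f (p ℕ.^ e) ≈ f p ^ e) where

    private
      f[p^e*m] : ∀ {p m} → Prime p → ¬ p ∣ m → ∀ e → f (p ℕ.^ e ℕ.* m) ≈ f p ^ e * f m
      f[p^e*m] {p} pp p∤m e = trans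
        (proj₂ mult _ _ (1≤p^a (prime>1 pp) e) (n≢0⇒n>0 λ { ≡.refl → p∤m (p ∣0) }) (coprime-p^e pp p∤m e))
        (*-congʳ (geometric pp e))

      f[p*x] : ∀ {p} → Prime p → ∀ x → 1 ℕ.≤ x → f (p ℕ.* x) ≈ f p * f x
      f[p*x] {p} pp x 1≤x with p-free-part (prime>1 pp) x 1≤x
      ... | e , m , ≡.refl , p∤m = begin
        f (p ℕ.* (p ℕ.^ e ℕ.* m))  ≡⟨ ≡.cong f (≡.sym (ℕₚ.*-assoc p (p ℕ.^ e) m)) ⟩
        f (p ℕ.^ suc e ℕ.* m)      ≈⟨ f[p^e*m] pp p∤m (suc e) ⟩
        (f p * f p ^ e) * f m      ≈⟨ *-assoc (f p) _ _ ⟩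
        f p * (f p ^ e * f m)      ≈⟨ *-congˡ (f[p^e*m] pp p∤m e) ⟨
        f p * f (p ℕ.^ e ℕ.* m)    ∎

    completely-multiplicative : CompletelyMultiplicative R f
    completely-multiplicative = proj₁ mult , λ m n → <-rec P step m n
      where
      P : ℕ → Set ℓ
      P m = ∀ n → 1 ℕ.≤ m → 1 ℕ.≤ n → f (m ℕ.* n) ≈ f m * f n
      step : ∀ m → (∀ {m′} → m′ < m → P m′) → P m
      step m rec n 1≤m 1≤n with m≤n⇒m<n∨m≡n 1≤m
      ... | inj₂ ≡.refl = begin
        f (1 ℕ.* n)  ≡⟨ ≡.cong f (ℕₚ.*-identityˡ n) ⟩
        f n          ≈⟨ *-identityˡ (f n) ⟨
        1# * f n     ≈⟨ *-congʳ (proj₁ mult) ⟨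
        f 1 * f n    ∎
      ... | inj₁ 1<m with ∃-prime-divisor 1<m
      ...   | p , pp , divides q ≡.refl = begin
        f (q ℕ.* p ℕ.* n)    ≡⟨ ≡.cong f (≡.trans (≡.cong (ℕ._* n) (ℕₚ.*-comm q p)) (ℕₚ.*-assoc p q n)) ⟩
        f (p ℕ.* (q ℕ.* n))  ≈⟨ f[p*x] pp (q ℕ.* n) (ℕₚ.*-mono-≤ 1≤q 1≤n) ⟩
        f p * f (q ℕ.* n)    ≈⟨ *-congˡ (rec q<q*p n 1≤q 1≤n) ⟩
        f p * (f q * f n)    ≈⟨ *-assoc (f p) (f q) (f n) ⟨
        f p * f q * f n      ≈⟨ *-congʳ (f[p*x] pp q 1≤q) ⟨
        f (p ℕ.* q) * f n    ≡⟨ ≡.cong (λ x → f x * f n) (ℕₚ.*-comm p q) ⟩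
        f (q ℕ.* p) * f n    ∎
        where
        1≤q : 1 ℕ.≤ q
        1≤q = n≢0⇒n>0 λ { ≡.refl → <⇒≢ (<-trans z<s 1<m) ≡.refl }
        q<q*p : q < q ℕ.* p
        q<q*p = ℕₚ.m<m*n q p {{ℕ.>-nonZero 1≤q}} (prime>1 pp)

  power-identity⇒geometric : IsField R → CharZero R → ∀ {f} → Multiplicative R f →
    ∀ k → 2 ℕ.≤ ∣ k ∣ → PowerIdentity R f k → ∀ {p} → Prime p → ∀ e → f (p ℕ.^ e) ≈ f p ^ e
  power-identity⇒geometric isField charZero {f} mult k 2≤∣k∣ identity {p} pp e =
    trans (on-powers k 2≤∣k∣ identity) (^-congˡ e (reflexive (≡.cong f (ℕₚ.*-identityʳ p))))
    where
    u = powerSeq p f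
    1≤p^ = 1≤p^a (prime>1 pp)
    Ω-exponent : ∀ {K K′} → K ≡ K′ → ∀ a → powR R K (Ω (p ℕ.^ a)) * u a ≡ K′ ^ a * u a
    Ω-exponent {K} ≡.refl a = ≡.cong (_* u a) (≡.trans (powR≡^ K (Ω (p ℕ.^ a))) (≡.cong (K ^_) (Ω-p^a≡a pp a)))
    on-powers : ∀ k → 2 ℕ.≤ ∣ k ∣ → PowerIdentity R f k → u e ≈ u 1 ^ e
    on-powers (+ k) 2≤k (lift identity) =
      ^⋆-scaling⇒geometric isField k (powers-avoid-self charZero 2≤k) u (proj₁ mult) scaling e
      where
      scaling : ∀ a → (u ^⋆ k) a ≈ (k · 1#) ^ a * u a
      scaling a = begin
        (u ^⋆ k) a                              ≈⟨ convPow-prime-power pp f k a ⟨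
        convPow R f k (p ℕ.^ a)                 ≈⟨ identity (p ℕ.^ a) (1≤p^ a) ⟩
        powR R (natR R k) (Ω (p ℕ.^ a)) * u a  ≡⟨ Ω-exponent (natR≡·1# k) a ⟩
        (k · 1#) ^ a * u a                      ∎
    on-powers -[1+ k ] 2≤1+k (g , inverse , identity) =
      inverse-^⋆-scaling⇒geometric isField (suc k) (negated-powers-avoid-self charZero 2≤1+k)
                                   u w (proj₁ mult) u⋆w≈ε scaling e
      where
      w = powerSeq p g
      u⋆w≈ε : ∀ a → (u ⋆ w) a ≈ ε⋆ a
      u⋆w≈ε a = trans (sym (⊚-prime-power pp f g a)) (trans (inverse (p ℕ.^ a) (1≤p^ a)) (δ-prime-power pp a))
      scaling : ∀ a → (w ^⋆ suc k) a ≈ (- (suc k · 1#)) ^ a * u a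
      scaling a = begin
        (w ^⋆ suc k) a                                 ≈⟨ convPow-prime-power pp g (suc k) a ⟨
        convPow R g (suc k) (p ℕ.^ a)                  ≈⟨ identity (p ℕ.^ a) (1≤p^ a) ⟩
        powR R (- natR R (suc k)) (Ω (p ℕ.^ a)) * u a  ≡⟨ Ω-exponent (≡.cong -_ (natR≡·1# (suc k))) a ⟩
        (- (suc k · 1#)) ^ a * u a                     ∎

theorem3p2 : {c ℓ : Level} (R : CommutativeRing c ℓ) → IsField R → CharZero R →
    (f : ArithFun R) → Multiplicative R f →
    (∃ λ (k : ℤ) → (2 ≤ ∣ k ∣) × PowerIdentity R f k) →
    CompletelyMultiplicative R f
theorem3p2 R isField charZero f mult (k , 2≤∣k∣ , identity) =
  completely-multiplicative R mult (power-identity⇒geometric R isField charZero mult k 2≤∣k∣ identity)
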